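{- Let $\psi$ be the map defined in the context. For every $n\geq0$, $\psi(\mathcal{E}'_n)$ is the set of Dyck paths in $\mathcal{B}_{n+1}$ ending with $UD$. Consequently, the map sending $P\in\mathcal{E}'_n$ to the path obtained from $\psi(P)$ by deleting its last two steps $UD$ is a bijection from $\mathcal{E}'_n$ onto $\mathcal{B}_n$.
   Context: Steps: $U=(1,1)$, $D=(1,-1)$, $F=(1,0)$, $D_i=(1,-i)$ for $i\geq2$; set $D_1=D$. A Motzkin meander with catastrophes of length $n$ is a sequence of $n$ steps from $\{U,D,F\}\cup\{D_i:i\geq2\}$ starting at $(0,0)$, never going below the $x$-axis, such that every step $D_i$ ($i\ge2$) ends on the $x$-axis; $\mathcal{M}'_n$ is the set of these, $\mathcal{M}'=\bigcup_n\mathcal{M}'_n$, and $\epsilon$ denotes the empty path. A Motzkin excursion with catastrophes is such a meander ending on the $x$-axis; $\mathcal{E}'_n$ is the set of those of length $n$. A Motzkin path is a path using only $U,D,F$, never below the $x$-axis, ending on the $x$-axis. An occurrence of a pattern (a factor of consecutive steps) is at height $h$ if the minimal ordinate of the points of the occurrence is $h$. $\mathcal{B}_m$ is the set of Dyck paths of semilength $m$ having no occurrence of $UUU$ at height $h\geq2$. $\chi$ maps a Motzkin path to a Dyck path by replacing each $U$ by $UUD$, each $F$ by $UD$, and each $D$ by $D$. The map $\psi:\mathcal{M}'\to\{\text{Dyck paths}\}$ is defined recursively: $\psi(\epsilon)=UD$; $\psi(F\alpha)=UD\,\psi(\alpha)$ for $\alpha\in\mathcal{M}'$; if $P$ starts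 with $U$ and never returns to the $x$-axis, then $P$ ends at some height $k\ge1$ and is uniquely written $P=U\alpha_1U\alpha_2\cdots U\alpha_k$ with $\alpha_1,\dots,\alpha_k$ (possibly empty) Motzkin paths (translated), and $\psi(P)=UU\chi(\alpha_1)DU\chi(\alpha_2)D\cdots U\chi(\alpha_k)DD$; if $P$ starts with $U$ and returns to the $x$-axis, with first step ending on the $x$-axis equal to $D_k$ ($k\geq1$), then $P=U\alpha_1U\alpha_2\cdots U\alpha_kD_k\beta$ with $\alpha_i$ (possibly empty) Motzkin paths and $\beta\in\mathcal{M}'$, and $\psi(P)=UU\chi(\alpha_1)DU\chi(\alpha_2)D\cdots U\chi(\alpha_k)DD\,\psi(\beta)$. -}

module Defs where

open import Data.Nat using (ℕ; zero; suc; _*_; _≥_; _∸_; _≡ᵇ_)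
open import Data.Bool using (if_then_else_)
open import Data.Maybe using (Maybe; just; nothing)
open import Data.List using (List; []; _∷_; _++_; length; concatMap)
open import Data.List.Relation.Unary.All using (All)
open import Data.Product using (_×_; ∃)
open import Relation.Binary.PropositionalEquality using (_≡_)
open import Relation.Nullary using (¬_)

-- Steps of Motzkin meanders with catastrophes.
--   U = (1,1), F = (1,0), D = D_1 = (1,-1), Dc k = D_{k+2} = (1,-(k+2)).
data Step : Set where
  U F D : Step
  Dc    : ℕ → Step

-- Dsuc j = D_{j+1}   (so Dsuc 0 = D = D_1, Dsuc (suc j) = D_{j+2})
Dsuc : ℕ → Step
Dsuc zero    = D
Dsuc (suc j) = Dc j

walk : ℕ → List Step → Maybe ℕ
walk h       []           = just h
walk h       (U ∷ p)      = walk (suc h) p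
walk h       (F ∷ p)      = walk h p
walk zero    (D ∷ p)      = nothing
walk (suc h) (D ∷ p)      = walk h p
walk h       (Dc k ∷ p)   = if h ≡ᵇ suc (suc k) then walk 0 p else nothing

IsMeander : List Step → Set
IsMeander p = ∃ λ h → walk 0 p ≡ just h

E' : ℕ → List Step → Set
E' n p = length p ≡ n × walk 0 p ≡ just 0

data Plain : Step → Set where
  pU : Plain U
  pF : Plain F
  pD : Plain D

IsMotzkin : List Step → Set
IsMotzkin p = All Plain p × walk 0 p ≡ just 0

data DStep : Set where
  u d : DStep

dwalk : ℕ → List DStep → Maybe ℕ
dwalk h       []      = just h
dwalk h       (u ∷ q) = dwalk (suc h) q
dwalk zero    (d ∷ q) = nothing
dwalk (suc h) (d ∷ q) = dwalk h q

IsDyck : List DStep → Set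
IsDyck q = dwalk 0 q ≡ just 0

-- HighUUU h q : the path q, started at height h, has an occurrence of UUU
-- at height ≥ 2 (the height of an occurrence of UUU is its starting height).
data HighUUU : ℕ → List DStep → Set where
  here  : ∀ {h q} → h ≥ 2 → HighUUU h (u ∷ u ∷ u ∷ q)
  thereU : ∀ {h q} → HighUUU (suc h) q → HighUUU h (u ∷ q)
  thereD : ∀ {h q} → HighUUU (h ∸ 1) q → HighUUU h (d ∷ q)

B : ℕ → List DStep → Set
B m q = IsDyck q × length q ≡ 2 * m × ¬ HighUUU 0 q

-- The map χ : Motzkin paths → Dyck paths  (U ↦ UUD, F ↦ UD, D ↦ D).
-- (The value on catastrophe steps is irrelevant: χ is only applied to
-- Motzkin paths.)
χ : List Step → List DStep
χ []         = []
χ (U ∷ p)    = u ∷ u ∷ d ∷ χ p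
χ (F ∷ p)    = u ∷ d ∷ χ p
χ (D ∷ p)    = d ∷ χ p
χ (Dc _ ∷ p) = χ p

block : List (List Step) → List Step
block []       = []
block (α ∷ αs) = U ∷ α ++ block αs

ψblock : List (List Step) → List DStep
ψblock αs = u ∷ concatMap (λ α → u ∷ χ α ++ d ∷ []) αs ++ d ∷ []

-- The map ψ, as the graph relation 'Ψ P Q' (meaning ψ(P) = Q), given by
-- exactly the recursive clauses of the definition.  A nonempty list
-- (α ∷ αs) of Motzkin paths has k = length (α ∷ αs) = suc (length αs),
-- and D_k = Dsuc (length αs).
data Ψ : List Step → List DStep → Set where
  ψ-ε  : Ψ [] (u ∷ d ∷ [])
  ψ-F  : ∀ {α q} → Ψ α q → Ψ (F ∷ α) (u ∷ d ∷ q)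
  ψ-U  : ∀ α αs → All IsMotzkin (α ∷ αs) →
         Ψ (block (α ∷ αs)) (ψblock (α ∷ αs))
  ψ-UD : ∀ α αs {β q} → All IsMotzkin (α ∷ αs) → Ψ β q →
         Ψ (block (α ∷ αs) ++ Dsuc (length αs) ∷ β) (ψblock (α ∷ αs) ++ q)

{-# OPTIONS --safe #-}
-- ψ is undone by reading the Dyck path from left to right: outside a block UD gives F
-- and UU opens a block; inside one, UD, UUD and D give F, U and D, and on returning to
-- height 1 a U opens the next αᵢ while a D closes the block with the catastrophe D_k.
-- Along this reading UUU never starts at height ≥ 2, every step of P costs two Dyck
-- steps, and the path ends with the UD that encodes ε; so ψ(E'ₙ) consists of paths of
-- B_{n+1} ending with UD. The reading is deterministic and injective, which makes ψ
-- injective and single-valued, and on every path of B_{n+1} ending with UD it runs to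
-- completion and produces an excursion. Deleting or appending the final UD moves
-- between B_{n+1} and B_n.
module Submission where

open import Defs
open import Data.Bool using (true; T)
open import Data.Nat using (ℕ; zero; suc; _+_; _*_; _≡ᵇ_; s≤s; z≤n)
open import Data.Nat.Properties using (+-suc; +-identityʳ; +-comm; *-suc; *-cancelˡ-≡; suc-injective; ≡ᵇ⇒≡)
open import Data.Maybe using (just)
open import Data.List using (List; []; _∷_; _++_; length; concatMap)
open import Data.List.Properties using (++-assoc; ++-identityʳ; ++-cancelʳ; length-++; ∷ʳ-++; concatMap-++)
open import Data.List.Relation.Unary.All using (All; []; _∷_)
open import Data.List.Relation.Unary.All.Properties using (++⁺)
open import Data.Product using (_×_; _,_; proj₂; ∃; ∃₂; ∃!)
open import Data.Empty using (⊥-elim)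
open import Relation.Binary.PropositionalEquality
open import Relation.Nullary using (¬_)
open ≡-Reasoning

≡ᵇ-refl : ∀ n → (n ≡ᵇ n) ≡ true
≡ᵇ-refl zero    = refl
≡ᵇ-refl (suc n) = ≡ᵇ-refl n

walk-++ : ∀ h p {h′} q → walk h p ≡ just h′ → walk h (p ++ q) ≡ walk h′ q
walk-++ h       []         q refl = refl
walk-++ h       (U ∷ p)    q e    = walk-++ (suc h) p q e
walk-++ h       (F ∷ p)    q e    = walk-++ h p q e
walk-++ zero    (D ∷ p)    q ()
walk-++ (suc h) (D ∷ p)    q e    = walk-++ h p q e
walk-++ h       (Dc k ∷ p) q e    with h ≡ᵇ suc (suc k)
... | true = walk-++ 0 p q e

walk-Dc : ∀ h k W {h′} → walk h (Dc k ∷ W) ≡ just h′ → h ≡ suc (suc k) × walk 0 W ≡ just h′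
walk-Dc h k W e with h ≡ᵇ suc (suc k) in eq
... | true = ≡ᵇ⇒≡ h _ (subst T (sym eq) _) , e

walk-Dsuc : ∀ k β → walk (suc k) (Dsuc k ∷ β) ≡ walk 0 β
walk-Dsuc zero    β = refl
walk-Dsuc (suc k) β rewrite ≡ᵇ-refl k = refl

walk-plain-suc : ∀ {a b} p → All Plain p → walk a p ≡ just b → walk (suc a) p ≡ just (suc b)
walk-plain-suc         []      []        refl = refl
walk-plain-suc         (U ∷ p) (pU ∷ ps) e    = walk-plain-suc p ps e
walk-plain-suc         (F ∷ p) (pF ∷ ps) e    = walk-plain-suc p ps e
walk-plain-suc {suc a} (D ∷ p) (pD ∷ ps) e    = walk-plain-suc p ps e

motzkin-walk : ∀ {α} → IsMotzkin α → ∀ h → walk h α ≡ just h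
motzkin-walk     (_ , e)    zero    = e
motzkin-walk {α} m@(ps , _) (suc h) = walk-plain-suc α ps (motzkin-walk m h)

motzkin-∷ʳ-F : ∀ {γ} → IsMotzkin γ → IsMotzkin (γ ++ F ∷ [])
motzkin-∷ʳ-F {γ} (ps , e) = ++⁺ ps (pF ∷ []) , walk-++ 0 γ _ e

motzkin-nest : ∀ {δ γ} → IsMotzkin δ → IsMotzkin γ → IsMotzkin (δ ++ U ∷ γ ++ D ∷ [])
motzkin-nest {δ} {γ} (ps , e) mγ@(qs , _) =
  ++⁺ ps (pU ∷ ++⁺ qs (pD ∷ [])) ,
  trans (walk-++ 0 δ _ e) (walk-++ 1 γ (D ∷ []) (motzkin-walk mγ 1))

walk-block : ∀ {αs} → All IsMotzkin αs → ∀ h W → walk h (block αs ++ W) ≡ walk (h + length αs) W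
walk-block             []       h W rewrite +-identityʳ h = refl
walk-block {α ∷ αs} (m ∷ ms) h W = begin
  walk (suc h) ((α ++ block αs) ++ W) ≡⟨ cong (walk (suc h)) (++-assoc α (block αs) W) ⟩
  walk (suc h) (α ++ block αs ++ W)   ≡⟨ walk-++ (suc h) α _ (motzkin-walk m (suc h)) ⟩
  walk (suc h) (block αs ++ W)        ≡⟨ walk-block ms (suc h) W ⟩
  walk (suc h + length αs) W          ≡⟨ cong (λ h′ → walk h′ W) (sym (+-suc h (length αs))) ⟩
  walk (h + length (α ∷ αs)) W        ∎

walk-block-Dsuc : ∀ {α αs} → All IsMotzkin (α ∷ αs) → ∀ β →
  walk 0 (block (α ∷ αs) ++ Dsuc (length αs) ∷ β) ≡ walk 0 β
walk-block-Dsuc {αs = αs} ms β = trans (walk-block ms 0 _) (walk-Dsuc (length αs) β)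

block-not-excursion : ∀ {α αs} → All IsMotzkin (α ∷ αs) → ¬ walk 0 (block (α ∷ αs)) ≡ just 0
block-not-excursion {α} {αs} ms e
  with trans (sym (walk-block ms 0 [])) (trans (cong (walk 0) (++-identityʳ (block (α ∷ αs)))) e)
... | ()

block-∷ʳ : ∀ αs γ → block αs ++ U ∷ γ ≡ block (αs ++ γ ∷ [])
block-∷ʳ []       γ = cong (U ∷_) (sym (++-identityʳ γ))
block-∷ʳ (α ∷ αs) γ = cong (U ∷_) (trans (++-assoc α (block αs) (U ∷ γ)) (cong (α ++_) (block-∷ʳ αs γ)))

-- block (reverse rs)
blockʳ : List (List Step) → List Step
blockʳ []       = []
blockʳ (γ ∷ rs) = blockʳ rs ++ U ∷ γ

blockʳ-as-block : ∀ γ rs → All IsMotzkin (γ ∷ rs) →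
  ∃₂ λ α αs → blockʳ (γ ∷ rs) ≡ block (α ∷ αs) × length αs ≡ length rs × All IsMotzkin (α ∷ αs)
blockʳ-as-block γ []       ms       = γ , [] , cong (U ∷_) (sym (++-identityʳ γ)) , refl , ms
blockʳ-as-block γ (δ ∷ rs) (m ∷ ms) with blockʳ-as-block δ rs ms
... | α , αs , eq , len , ms′ =
  α , αs ++ γ ∷ [] ,
  trans (cong (_++ U ∷ γ) eq) (block-∷ʳ (α ∷ αs) γ) ,
  trans (length-++ αs) (trans (+-comm (length αs) 1) (cong suc len)) ,
  ++⁺ ms′ (m ∷ [])

Ψ-cast : ∀ {P P′ Q} → P ≡ P′ → Ψ P Q → Ψ P′ Q
Ψ-cast refl ψ = ψ

-- Reading U α₁ U α₂ ⋯ from left to right, every U is first taken to open a new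
-- αᵢ; a later D that would leave the current αᵢ nests it, with its opening U,
-- into αᵢ₋₁.  The αᵢ are kept in reverse order, the current one in front.
mutual
  ψ-total : ∀ P → walk 0 P ≡ just 0 → ∃ (Ψ P)
  ψ-total []      _ = _ , ψ-ε
  ψ-total (F ∷ P) e with ψ-total P e
  ... | _ , ψ = _ , ψ-F ψ
  ψ-total (U ∷ P) e = ψ-total-block [] [] ([] , refl) [] P e
  ψ-total (D ∷ P)    ()
  ψ-total (Dc k ∷ P) ()

  ψ-total-block : ∀ γ rs → IsMotzkin γ → All IsMotzkin rs → ∀ W →
    walk (suc (length rs)) W ≡ just 0 → ∃ (Ψ (blockʳ rs ++ U ∷ γ ++ W))
  ψ-total-block γ rs mγ ms [] ()
  ψ-total-block γ rs mγ ms (U ∷ W) e with ψ-total-block [] (γ ∷ rs) ([] , refl) (mγ ∷ ms) W e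
  ... | _ , ψ = _ , Ψ-cast (++-assoc (blockʳ rs) (U ∷ γ) (U ∷ W)) ψ
  ψ-total-block γ rs mγ ms (F ∷ W) e with ψ-total-block (γ ++ F ∷ []) rs (motzkin-∷ʳ-F mγ) ms W e
  ... | _ , ψ = _ , Ψ-cast (cong (λ γW → blockʳ rs ++ U ∷ γW) (++-assoc γ (F ∷ []) W)) ψ
  ψ-total-block γ [] mγ [] (D ∷ W) e with ψ-total W e
  ... | _ , ψ = _ , Ψ-cast (cong (λ γ′ → U ∷ γ′ ++ D ∷ W) (++-identityʳ γ)) (ψ-UD γ [] (mγ ∷ []) ψ)
  ψ-total-block γ (δ ∷ rs) mγ (mδ ∷ ms) (D ∷ W) e
    with ψ-total-block (δ ++ U ∷ γ ++ D ∷ []) rs (motzkin-nest mδ mγ) ms W e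
  ... | _ , ψ = _ , Ψ-cast nest ψ
    where
    nest : blockʳ rs ++ U ∷ (δ ++ U ∷ γ ++ D ∷ []) ++ W ≡ blockʳ (δ ∷ rs) ++ U ∷ γ ++ D ∷ W
    nest = begin
      blockʳ rs ++ U ∷ (δ ++ U ∷ γ ++ D ∷ []) ++ W
        ≡⟨ cong (λ x → blockʳ rs ++ U ∷ x) (++-assoc δ _ W) ⟩
      blockʳ rs ++ U ∷ δ ++ U ∷ (γ ++ D ∷ []) ++ W
        ≡⟨ cong (λ x → blockʳ rs ++ U ∷ δ ++ U ∷ x) (++-assoc γ (D ∷ []) W) ⟩
      blockʳ rs ++ U ∷ δ ++ U ∷ γ ++ D ∷ W
        ≡⟨ ++-assoc (blockʳ rs) (U ∷ δ) _ ⟨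
      blockʳ (δ ∷ rs) ++ U ∷ γ ++ D ∷ W ∎
  ψ-total-block γ rs mγ ms (Dc k ∷ W) e
    with walk-Dc (suc (length rs)) k W e | blockʳ-as-block γ rs (mγ ∷ ms)
  ... | height , e′ | α , αs , eq , len , ms′ with ψ-total W e′
  ... | _ , ψ = _ , Ψ-cast catastrophe (ψ-UD α αs ms′ ψ)
    where
    catastrophe : block (α ∷ αs) ++ Dsuc (length αs) ∷ W ≡ blockʳ rs ++ U ∷ γ ++ Dc k ∷ W
    catastrophe = begin
      block (α ∷ αs) ++ Dsuc (length αs) ∷ W
        ≡⟨ cong (λ n → block (α ∷ αs) ++ Dsuc n ∷ W) (trans len (suc-injective height)) ⟩
      block (α ∷ αs) ++ Dc k ∷ W   ≡⟨ cong (_++ Dc k ∷ W) eq ⟨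
      blockʳ (γ ∷ rs) ++ Dc k ∷ W  ≡⟨ ++-assoc (blockʳ rs) (U ∷ γ) (Dc k ∷ W) ⟩
      blockʳ rs ++ U ∷ γ ++ Dc k ∷ W ∎

-- The inverse of ψ, read from left to right.  DecodesIn j ℓ q X: inside a block
-- UU χ(α₁) D ⋯ U χ(αₖ) DD of ψ(P), after χ(α₁), …, χ(αⱼ) and at height ℓ within
-- χ(αⱼ₊₁), the remaining Dyck steps q encode the remaining steps X of P.
mutual
  data Decodes : List DStep → List Step → Set where
    finish : Decodes (u ∷ d ∷ []) []
    flat   : ∀ {q X} → Decodes q X → Decodes (u ∷ d ∷ q) (F ∷ X)
    enter  : ∀ {q X} → DecodesIn 0 0 q X → Decodes (u ∷ u ∷ q) (U ∷ X)

  data DecodesIn : ℕ → ℕ → List DStep → List Step → Set where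
    flat    : ∀ {j ℓ q X} → DecodesIn j ℓ q X → DecodesIn j ℓ (u ∷ d ∷ q) (F ∷ X)
    up      : ∀ {j ℓ q X} → DecodesIn j (suc ℓ) q X → DecodesIn j ℓ (u ∷ u ∷ d ∷ q) (U ∷ X)
    down    : ∀ {j ℓ q X} → DecodesIn j ℓ q X → DecodesIn j (suc ℓ) (d ∷ q) (D ∷ X)
    next    : ∀ {j q X} → DecodesIn (suc j) 0 q X → DecodesIn j 0 (d ∷ u ∷ q) (U ∷ X)
    close₁  : ∀ {q X} → Decodes q X → DecodesIn 0 0 (d ∷ d ∷ q) (D ∷ X)
    close₂₊ : ∀ {k q X} → Decodes q X → DecodesIn (suc k) 0 (d ∷ d ∷ q) (Dc k ∷ X)

close : ∀ j {q X} → Decodes q X → DecodesIn j 0 (d ∷ d ∷ q) (Dsuc j ∷ X)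
close zero    = close₁
close (suc j) = close₂₊

decodes-χ : ∀ {j a b r X} α → All Plain α → walk a α ≡ just b →
  DecodesIn j b r X → DecodesIn j a (χ α ++ r) (α ++ X)
decodes-χ             []      []        refl δ = δ
decodes-χ             (U ∷ α) (pU ∷ ps) e    δ = up (decodes-χ α ps e δ)
decodes-χ             (F ∷ α) (pF ∷ ps) e    δ = flat (decodes-χ α ps e δ)
decodes-χ {a = suc a} (D ∷ α) (pD ∷ ps) e    δ = down (decodes-χ α ps e δ)

χ-bracket : List Step → List DStep
χ-bracket α = u ∷ χ α ++ d ∷ []

∷ʳ-++-++ : ∀ {A : Set} (xs : List A) x ys zs → ((xs ++ x ∷ []) ++ ys) ++ zs ≡ xs ++ x ∷ ys ++ zs
∷ʳ-++-++ xs x ys zs = trans (++-assoc (xs ++ x ∷ []) ys zs) (∷ʳ-++ xs x (ys ++ zs))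

decodes-blocks : ∀ j {α αs q β} → All IsMotzkin (α ∷ αs) → Decodes q β →
  DecodesIn j 0 (χ α ++ d ∷ concatMap χ-bracket αs ++ d ∷ q) (α ++ block αs ++ Dsuc (j + length αs) ∷ β)
decodes-blocks j {α} {[]} ((ps , e) ∷ []) δ rewrite +-identityʳ j = decodes-χ α ps e (close j δ)
decodes-blocks j {α} {α′ ∷ αs} {q} {β} ((ps , e) ∷ ms) δ rewrite +-suc j (length αs) =
  subst₂ (DecodesIn j 0) opened nested (decodes-χ α ps e (next (decodes-blocks (suc j) ms δ)))
  where
  opened : χ α ++ d ∷ u ∷ χ α′ ++ d ∷ concatMap χ-bracket αs ++ d ∷ q
         ≡ χ α ++ d ∷ concatMap χ-bracket (α′ ∷ αs) ++ d ∷ q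
  opened = cong (λ x → χ α ++ d ∷ u ∷ x) (sym (∷ʳ-++-++ (χ α′) d (concatMap χ-bracket αs) (d ∷ q)))
  nested : α ++ U ∷ α′ ++ block αs ++ Dsuc (suc (j + length αs)) ∷ β
         ≡ α ++ block (α′ ∷ αs) ++ Dsuc (suc (j + length αs)) ∷ β
  nested = cong (λ x → α ++ U ∷ x) (sym (++-assoc α′ (block αs) _))

ψ⇒decodes : ∀ {P Q} → Ψ P Q → walk 0 P ≡ just 0 → Decodes Q P
ψ⇒decodes ψ-ε            _ = finish
ψ⇒decodes (ψ-F ψ)        e = flat (ψ⇒decodes ψ e)
ψ⇒decodes (ψ-U α αs ms)  e = ⊥-elim (block-not-excursion ms e)
ψ⇒decodes (ψ-UD α αs {β} {q} ms ψ) e =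
  subst₂ Decodes opened blocks (enter (decodes-blocks 0 ms (ψ⇒decodes ψ e′)))
  where
  e′ : walk 0 β ≡ just 0
  e′ = trans (sym (walk-block-Dsuc ms β)) e
  C : List DStep
  C = concatMap χ-bracket αs
  opened : u ∷ u ∷ χ α ++ d ∷ C ++ d ∷ q ≡ ψblock (α ∷ αs) ++ q
  opened = cong (λ x → u ∷ u ∷ x)
    (sym (trans (++-assoc ((χ α ++ d ∷ []) ++ C) (d ∷ []) q) (∷ʳ-++-++ (χ α) d C (d ∷ q))))
  blocks : U ∷ α ++ block αs ++ Dsuc (length αs) ∷ β ≡ block (α ∷ αs) ++ Dsuc (length αs) ∷ β
  blocks = cong (U ∷_) (sym (++-assoc α (block αs) _))

mutual
  decodes-dyck : ∀ {q X} → Decodes q X → IsDyck q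
  decodes-dyck finish    = refl
  decodes-dyck (flat δ)  = decodes-dyck δ
  decodes-dyck (enter δ) = decodesIn-dyck δ

  decodesIn-dyck : ∀ {j ℓ q X} → DecodesIn j ℓ q X → dwalk (2 + ℓ) q ≡ just 0
  decodesIn-dyck (flat δ)    = decodesIn-dyck δ
  decodesIn-dyck (up δ)      = decodesIn-dyck δ
  decodesIn-dyck (down δ)    = decodesIn-dyck δ
  decodesIn-dyck (next δ)    = decodesIn-dyck δ
  decodesIn-dyck (close₁ δ)  = decodes-dyck δ
  decodesIn-dyck (close₂₊ δ) = decodes-dyck δ

mutual
  decodes-¬highUUU : ∀ {q X} → Decodes q X → ¬ HighUUU 0 q
  decodes-¬highUUU finish    (thereU (thereD ()))
  decodes-¬highUUU (flat δ)  (thereU (thereD h))        = decodes-¬highUUU δ h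
  decodes-¬highUUU (enter δ) (here ())
  decodes-¬highUUU (enter δ) (thereU (here (s≤s ())))
  decodes-¬highUUU (enter δ) (thereU (thereU h))        = decodesIn-¬highUUU δ h

  decodesIn-¬highUUU : ∀ {j ℓ q X} → DecodesIn j ℓ q X → ¬ HighUUU (2 + ℓ) q
  decodesIn-¬highUUU (flat δ)    (thereU (thereD h))           = decodesIn-¬highUUU δ h
  decodesIn-¬highUUU (up δ)      (thereU (thereU (thereD h)))  = decodesIn-¬highUUU δ h
  decodesIn-¬highUUU (down δ)    (thereD h)                    = decodesIn-¬highUUU δ h
  decodesIn-¬highUUU (next δ)    (thereD (here (s≤s ())))
  decodesIn-¬highUUU (next δ)    (thereD (thereU h))           = decodesIn-¬highUUU δ h
  decodesIn-¬highUUU (close₁ δ)  (thereD (thereD h))           = decodes-¬highUUU δ h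
  decodesIn-¬highUUU (close₂₊ δ) (thereD (thereD h))           = decodes-¬highUUU δ h

2+-2*suc : ∀ {a} n → a ≡ 2 * suc n → 2 + a ≡ 2 * suc (suc n)
2+-2*suc n e = trans (cong (2 +_) e) (sym (*-suc 2 (suc n)))

mutual
  decodes-length : ∀ {q X} → Decodes q X → length q ≡ 2 * suc (length X)
  decodes-length finish                = refl
  decodes-length (flat {X = X} δ)      = 2+-2*suc (length X) (decodes-length δ)
  decodes-length (enter {q} {X} δ)     =
    2+-2*suc (length X) (trans (sym (+-identityʳ (length q))) (decodesIn-length δ))

  decodesIn-length : ∀ {j ℓ q X} → DecodesIn j ℓ q X → length q + ℓ ≡ 2 * suc (length X)
  decodesIn-length (flat {X = X} δ)           = 2+-2*suc (length X) (decodesIn-length δ)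
  decodesIn-length (up {ℓ = ℓ} {q} {X} δ)     =
    2+-2*suc (length X) (trans (sym (+-suc (length q) ℓ)) (decodesIn-length δ))
  decodesIn-length (down {ℓ = ℓ} {q} {X} δ)   =
    trans (cong suc (+-suc (length q) ℓ)) (2+-2*suc (length X) (decodesIn-length δ))
  decodesIn-length (next {X = X} δ)           = 2+-2*suc (length X) (decodesIn-length δ)
  decodesIn-length (close₁ {q} {X} δ)         =
    2+-2*suc (length X) (trans (+-identityʳ (length q)) (decodes-length δ))
  decodesIn-length (close₂₊ {q = q} {X} δ)    =
    2+-2*suc (length X) (trans (+-identityʳ (length q)) (decodes-length δ))

EndsWithUD : List DStep → Set
EndsWithUD Q = ∃ λ R → Q ≡ R ++ u ∷ d ∷ []

++-endsWithUD : ∀ p {q} → EndsWithUD q → EndsWithUD (p ++ q)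
++-endsWithUD p (R , refl) = p ++ R , sym (++-assoc p R _)

mutual
  decodes-endsWithUD : ∀ {q X} → Decodes q X → EndsWithUD q
  decodes-endsWithUD finish    = [] , refl
  decodes-endsWithUD (flat δ)  = ++-endsWithUD (u ∷ d ∷ []) (decodes-endsWithUD δ)
  decodes-endsWithUD (enter δ) = ++-endsWithUD (u ∷ u ∷ []) (decodesIn-endsWithUD δ)

  decodesIn-endsWithUD : ∀ {j ℓ q X} → DecodesIn j ℓ q X → EndsWithUD q
  decodesIn-endsWithUD (flat δ)    = ++-endsWithUD (u ∷ d ∷ []) (decodesIn-endsWithUD δ)
  decodesIn-endsWithUD (up δ)      = ++-endsWithUD (u ∷ u ∷ d ∷ []) (decodesIn-endsWithUD δ)
  decodesIn-endsWithUD (down δ)    = ++-endsWithUD (d ∷ []) (decodesIn-endsWithUD δ)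
  decodesIn-endsWithUD (next δ)    = ++-endsWithUD (d ∷ u ∷ []) (decodesIn-endsWithUD δ)
  decodesIn-endsWithUD (close₁ δ)  = ++-endsWithUD (d ∷ d ∷ []) (decodes-endsWithUD δ)
  decodesIn-endsWithUD (close₂₊ δ) = ++-endsWithUD (d ∷ d ∷ []) (decodes-endsWithUD δ)

mutual
  decodes-functional : ∀ {q X Y} → Decodes q X → Decodes q Y → X ≡ Y
  decodes-functional finish    finish    = refl
  decodes-functional finish    (flat ())
  decodes-functional (flat ()) finish
  decodes-functional (flat δ)  (flat ε)  = cong (F ∷_) (decodes-functional δ ε)
  decodes-functional (enter δ) (enter ε) = cong (U ∷_) (decodesIn-functional δ ε)

  decodesIn-functional : ∀ {j ℓ q X Y} → DecodesIn j ℓ q X → DecodesIn j ℓ q Y → X ≡ Y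
  decodesIn-functional (flat δ)    (flat ε)    = cong (F ∷_) (decodesIn-functional δ ε)
  decodesIn-functional (up δ)      (up ε)      = cong (U ∷_) (decodesIn-functional δ ε)
  decodesIn-functional (down δ)    (down ε)    = cong (D ∷_) (decodesIn-functional δ ε)
  decodesIn-functional (next δ)    (next ε)    = cong (U ∷_) (decodesIn-functional δ ε)
  decodesIn-functional (close₁ δ)  (close₁ ε)  = cong (D ∷_) (decodes-functional δ ε)
  decodesIn-functional (close₂₊ δ) (close₂₊ ε) = cong (Dc _ ∷_) (decodes-functional δ ε)

-- Both an up-step inside αⱼ₊₁ and the opening of αⱼ₊₂ produce U, so injectivity
-- has to compare any two states at the same height 1 + ℓ + j of P.
mutual
  decodes-injective : ∀ {q₁ q₂ X} → Decodes q₁ X → Decodes q₂ X → q₁ ≡ q₂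
  decodes-injective finish     finish     = refl
  decodes-injective (flat δ₁)  (flat δ₂)  = cong (λ q → u ∷ d ∷ q) (decodes-injective δ₁ δ₂)
  decodes-injective (enter δ₁) (enter δ₂) with decodesIn-injective δ₁ δ₂ refl
  ... | refl = refl

  decodesIn-injective : ∀ {j₁ ℓ₁ q₁ j₂ ℓ₂ q₂ X} → DecodesIn j₁ ℓ₁ q₁ X → DecodesIn j₂ ℓ₂ q₂ X →
    ℓ₁ + j₁ ≡ ℓ₂ + j₂ → _≡_ {A = ℕ × ℕ × List DStep} (j₁ , ℓ₁ , q₁) (j₂ , ℓ₂ , q₂)
  decodesIn-injective (flat δ₁)    (flat δ₂)    h with decodesIn-injective δ₁ δ₂ h
  ... | refl = refl
  decodesIn-injective (up δ₁)      (up δ₂)      h with decodesIn-injective δ₁ δ₂ (cong suc h)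
  ... | refl = refl
  decodesIn-injective (up δ₁)      (next δ₂)    h with decodesIn-injective δ₁ δ₂ (cong suc h)
  ... | ()
  decodesIn-injective (next δ₁)    (up δ₂)      h with decodesIn-injective δ₁ δ₂ (cong suc h)
  ... | ()
  decodesIn-injective (next δ₁)    (next δ₂)    h with decodesIn-injective δ₁ δ₂ (cong suc h)
  ... | refl = refl
  decodesIn-injective (down δ₁)    (down δ₂)    h with decodesIn-injective δ₁ δ₂ (suc-injective h)
  ... | refl = refl
  decodesIn-injective (down δ₁)    (close₁ δ₂)  ()
  decodesIn-injective (close₁ δ₁)  (down δ₂)    ()
  decodesIn-injective (close₁ δ₁)  (close₁ δ₂)  h with decodes-injective δ₁ δ₂
  ... | refl = refl
  decodesIn-injective (close₂₊ δ₁) (close₂₊ δ₂) h with decodes-injective δ₁ δ₂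
  ... | refl = refl

χ-++ : ∀ α β → χ (α ++ β) ≡ χ α ++ χ β
χ-++ []         β = refl
χ-++ (U ∷ α)    β = cong (λ q → u ∷ u ∷ d ∷ q) (χ-++ α β)
χ-++ (F ∷ α)    β = cong (λ q → u ∷ d ∷ q) (χ-++ α β)
χ-++ (D ∷ α)    β = cong (d ∷_) (χ-++ α β)
χ-++ (Dc _ ∷ α) β = χ-++ α β

χ-∷ʳ : ∀ γ x r → χ (γ ++ x ∷ []) ++ r ≡ χ γ ++ χ (x ∷ []) ++ r
χ-∷ʳ γ x r = trans (cong (_++ r) (χ-++ γ (x ∷ []))) (++-assoc (χ γ) _ r)

concatMap-χ-bracket-∷ʳ : ∀ αs γ r →
  concatMap χ-bracket (αs ++ γ ∷ []) ++ r ≡ concatMap χ-bracket αs ++ u ∷ χ γ ++ d ∷ r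
concatMap-χ-bracket-∷ʳ αs γ r = begin
  concatMap χ-bracket (αs ++ γ ∷ []) ++ r
    ≡⟨ cong (_++ r) (concatMap-++ χ-bracket αs (γ ∷ [])) ⟩
  (concatMap χ-bracket αs ++ χ-bracket γ ++ []) ++ r
    ≡⟨ ++-assoc (concatMap χ-bracket αs) _ r ⟩
  concatMap χ-bracket αs ++ (χ-bracket γ ++ []) ++ r
    ≡⟨ cong (λ x → concatMap χ-bracket αs ++ x ++ r) (++-identityʳ (χ-bracket γ)) ⟩
  concatMap χ-bracket αs ++ u ∷ (χ γ ++ d ∷ []) ++ r
    ≡⟨ cong (λ x → concatMap χ-bracket αs ++ u ∷ x) (∷ʳ-++ (χ γ) d r) ⟩
  concatMap χ-bracket αs ++ u ∷ χ γ ++ d ∷ r ∎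

∷ʳ-as-∷ : ∀ {A : Set} (xs : List A) y → ∃₂ λ z zs → xs ++ y ∷ [] ≡ z ∷ zs
∷ʳ-as-∷ []       y = y , [] , refl
∷ʳ-as-∷ (x ∷ xs) y = x , xs ++ y ∷ [] , refl

Preimage : List DStep → Set
Preimage Q = ∃ λ P → walk 0 P ≡ just 0 × Ψ P Q

ud : List DStep
ud = u ∷ d ∷ []

-- The same three reading states as the decoder: outside any block, between two
-- αᵢ of a block, and inside the current αᵢ (read so far as cur, at height ℓ).
mutual
  preimage : ∀ R → IsDyck (R ++ ud) → ¬ HighUUU 0 (R ++ ud) → Preimage (R ++ ud)
  preimage []          _  _  = [] , refl , ψ-ε
  preimage (u ∷ d ∷ R) dw nh with preimage R dw (λ h → nh (thereU (thereD h)))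
  ... | P , w , ψ = F ∷ P , w , ψ-F ψ
  preimage (u ∷ u ∷ R) dw nh =
    preimage-inside [] [] [] refl [] R dw (λ h → nh (thereU (thereU h)))
  preimage (u ∷ [])    () _
  preimage (d ∷ R)     () _

  preimage-between : ∀ α αs → All IsMotzkin (α ∷ αs) → ∀ R →
    dwalk 1 (R ++ ud) ≡ just 0 → ¬ HighUUU 1 (R ++ ud) →
    Preimage (u ∷ concatMap χ-bracket (α ∷ αs) ++ R ++ ud)
  preimage-between α αs ms []      () _
  preimage-between α αs ms (u ∷ R) dw nh =
    preimage-inside (α ∷ αs) [] [] refl ms R dw (λ h → nh (thereU h))
  preimage-between α αs ms (d ∷ R) dw nh with preimage R dw (λ h → nh (thereD h))
  ... | β , w , ψ =
    block (α ∷ αs) ++ Dsuc (length αs) ∷ β ,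
    trans (walk-block-Dsuc ms β) w ,
    subst (Ψ _) (cong (u ∷_) (++-assoc (concatMap χ-bracket (α ∷ αs)) (d ∷ []) _)) (ψ-UD α αs ms ψ)

  preimage-inside : ∀ {ℓ} done cur → All Plain cur → walk 0 cur ≡ just ℓ → All IsMotzkin done →
    ∀ R → dwalk (2 + ℓ) (R ++ ud) ≡ just 0 → ¬ HighUUU (2 + ℓ) (R ++ ud) →
    Preimage (u ∷ concatMap χ-bracket done ++ u ∷ χ cur ++ R ++ ud)
  preimage-inside done cur ps wc ms (u ∷ d ∷ R) dw nh =
    subst Preimage (cong (λ x → u ∷ concatMap χ-bracket done ++ u ∷ x) (χ-∷ʳ cur F (R ++ ud)))
      (preimage-inside done (cur ++ F ∷ []) (++⁺ ps (pF ∷ [])) (walk-++ 0 cur _ wc) ms R dw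
        (λ h → nh (thereU (thereD h))))
  preimage-inside done cur ps wc ms (u ∷ u ∷ d ∷ R) dw nh =
    subst Preimage (cong (λ x → u ∷ concatMap χ-bracket done ++ u ∷ x) (χ-∷ʳ cur U (R ++ ud)))
      (preimage-inside done (cur ++ U ∷ []) (++⁺ ps (pU ∷ [])) (walk-++ 0 cur _ wc) ms R dw
        (λ h → nh (thereU (thereU (thereD h)))))
  preimage-inside {suc ℓ} done cur ps wc ms (d ∷ R) dw nh =
    subst Preimage (cong (λ x → u ∷ concatMap χ-bracket done ++ u ∷ x) (χ-∷ʳ cur D (R ++ ud)))
      (preimage-inside done (cur ++ D ∷ []) (++⁺ ps (pD ∷ [])) (walk-++ 0 cur _ wc) ms R dw
        (λ h → nh (thereD h)))
  preimage-inside {zero} done cur ps wc ms (d ∷ R) dw nh with ∷ʳ-as-∷ done cur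
  ... | α , αs , eq =
    subst Preimage (cong (u ∷_) (trans (cong (λ βs → concatMap χ-bracket βs ++ R ++ ud) (sym eq))
                                        (concatMap-χ-bracket-∷ʳ done cur (R ++ ud))))
      (preimage-between α αs (subst (All IsMotzkin) eq (++⁺ ms ((ps , wc) ∷ []))) R dw
        (λ h → nh (thereD h)))
  preimage-inside done cur ps wc ms (u ∷ u ∷ u ∷ R) dw nh = ⊥-elim (nh (here (s≤s (s≤s z≤n))))
  preimage-inside done cur ps wc ms (u ∷ u ∷ []) dw nh = ⊥-elim (nh (here (s≤s (s≤s z≤n))))
  preimage-inside done cur ps wc ms (u ∷ []) () nh
  preimage-inside done cur ps wc ms [] () nh

dwalk-++-ud : ∀ h R → dwalk h (R ++ ud) ≡ dwalk h R
dwalk-++-ud h       []      = refl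
dwalk-++-ud h       (u ∷ R) = dwalk-++-ud (suc h) R
dwalk-++-ud zero    (d ∷ R) = refl
dwalk-++-ud (suc h) (d ∷ R) = dwalk-++-ud h R

highUUU-++ : ∀ {h R} X → HighUUU h R → HighUUU h (R ++ X)
highUUU-++ X (here p)   = here p
highUUU-++ X (thereU x) = thereU (highUUU-++ X x)
highUUU-++ X (thereD x) = thereD (highUUU-++ X x)

-- the hypothesis rules out R ending with UU, which would create UUU with the appended U
highUUU-++-ud⁻ : ∀ h R → dwalk h R ≡ just 0 → HighUUU h (R ++ ud) → HighUUU h R
highUUU-++-ud⁻ h       []                   _  (thereU (thereD ()))
highUUU-++-ud⁻ h       (u ∷ [])             () _
highUUU-++-ud⁻ h       (u ∷ u ∷ [])         () _
highUUU-++-ud⁻ h       (u ∷ u ∷ u ∷ R)      _  (here p)   = here p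
highUUU-++-ud⁻ h       (u ∷ R@(_ ∷ _))      dw (thereU x) = thereU (highUUU-++-ud⁻ (suc h) R dw x)
highUUU-++-ud⁻ zero    (d ∷ R)              () _
highUUU-++-ud⁻ (suc h) (d ∷ R)              dw (thereD x) = thereD (highUUU-++-ud⁻ h R dw x)

length-++-ud : ∀ R → length (R ++ ud) ≡ 2 + length R
length-++-ud R = trans (length-++ R) (+-comm (length R) 2)

B-++-ud⁺ : ∀ {n R} → B n R → B (suc n) (R ++ ud)
B-++-ud⁺ {n} {R} (dw , len , nh) =
  trans (dwalk-++-ud 0 R) dw ,
  trans (length-++-ud R) (trans (cong (2 +_) len) (sym (*-suc 2 n))) ,
  λ h → nh (highUUU-++-ud⁻ 0 R dw h)

B-++-ud⁻ : ∀ {n R} → B (suc n) (R ++ ud) → B n R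
B-++-ud⁻ {n} {R} (dw , len , nh) =
  trans (sym (dwalk-++-ud 0 R)) dw ,
  suc-injective (suc-injective (trans (sym (length-++-ud R)) (trans len (*-suc 2 n)))) ,
  λ h → nh (highUUU-++ ud h)

decodes⇒B : ∀ {Q P} → Decodes Q P → B (suc (length P)) Q
decodes⇒B δ = decodes-dyck δ , decodes-length δ , decodes-¬highUUU δ

ψ-image-in-B : ∀ {n P Q} → E' n P → Ψ P Q → B (suc n) Q
ψ-image-in-B (refl , w) ψ = decodes⇒B (ψ⇒decodes ψ w)

preimage-in-E' : ∀ {n} R → B (suc n) (R ++ ud) → ∃ λ P → E' n P × Ψ P (R ++ ud)
preimage-in-E' {n} R (dw , len , nh) with preimage R dw nh
... | P , w , ψ =
  P , (suc-injective (*-cancelˡ-≡ _ _ 2 (trans (sym (decodes-length (ψ⇒decodes ψ w))) len)) , w) , ψ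

corollary1 : (n : ℕ) →
    -- ψ(E'_n) = { Q ∈ B_{n+1} : Q ends with UD }
    ((Q : List DStep) →
        ((∃ λ P → E' n P × Ψ P Q) → B (suc n) Q × ∃ λ R → Q ≡ R ++ u ∷ d ∷ [])
      × (B (suc n) Q × (∃ λ R → Q ≡ R ++ u ∷ d ∷ []) → ∃ λ P → E' n P × Ψ P Q))
    -- P ↦ ψ(P) with its final UD deleted is a well-defined map E'_n → B_n ...
    × ((P : List Step) → E' n P → ∃! _≡_ λ R → Ψ P (R ++ u ∷ d ∷ []))
    × ((P : List Step) (R : List DStep) → E' n P → Ψ P (R ++ u ∷ d ∷ []) → B n R)
    -- ... which is injective ...
    × ((P P′ : List Step) (R : List DStep) → E' n P → E' n P′ →
         Ψ P (R ++ u ∷ d ∷ []) → Ψ P′ (R ++ u ∷ d ∷ []) → P ≡ P′)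
    -- ... and surjective onto B_n.
    × ((R : List DStep) → B n R → ∃ λ P → E' n P × Ψ P (R ++ u ∷ d ∷ []))
corollary1 n =
  (λ Q → (λ { (P , e , ψ) → ψ-image-in-B e ψ , decodes-endsWithUD (ψ⇒decodes ψ (proj₂ e)) })
       , (λ { (b , R , refl) → preimage-in-E' R b })) ,
  image-unique ,
  (λ _ _ e ψ → B-++-ud⁻ (ψ-image-in-B e ψ)) ,
  (λ _ _ _ (_ , w) (_ , w′) ψ ψ′ → decodes-functional (ψ⇒decodes ψ w) (ψ⇒decodes ψ′ w′)) ,
  (λ R b → preimage-in-E' R (B-++-ud⁺ b))
  where
  image-unique : (P : List Step) → E' n P → ∃! _≡_ λ R → Ψ P (R ++ u ∷ d ∷ [])
  image-unique P (_ , w) with ψ-total P w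
  ... | Q , ψ with decodes-endsWithUD (ψ⇒decodes ψ w)
  ... | R , refl =
    R , ψ , λ ψ′ → ++-cancelʳ ud R _ (decodes-injective (ψ⇒decodes ψ w) (ψ⇒decodes ψ′ w))
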